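{- Let $P$ be a $0$-$1$ matrix having a row $r$ with ones in two adjacent columns $c$ and $c+1$. Let $R$ be the $0$-$1$ matrix obtained from $P$ by inserting a new column between columns $c$ and $c+1$ whose entry in row $r$ is $1$ and whose other entries are $0$. Then for every $m$, $sm(m,P) \leq sm(m,R) \leq 2\, sm(m,P)$.
   Context: A $0$-$1$ matrix $A$ contains a $0$-$1$ matrix $P$ if some submatrix of $A$ (obtained by selecting a subset of rows and a subset of columns, preserving order) either equals $P$ or can be changed into $P$ by turning some ones into zeroes; otherwise $A$ avoids $P$. For $0$-$1$ matrices $A, P$, $LSM(A,P)$ is the maximum number of ones in a $P$-avoiding $0$-$1$ matrix $B$ that is contained in $A$. $sm(m,P)$ is the minimum of $LSM(A,P)$ over all $0$-$1$ matrices $A$ with exactly $m$ ones. -}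

module Defs where

open import Data.Nat using (ℕ; zero; suc; _+_; _≤_)
open import Data.Bool using (Bool; true; false; if_then_else_)
open import Data.Fin using (Fin; zero; suc; inject₁; punchOut; _<_)
open import Data.Fin.Properties using (_≟_)
open import Data.List using (List; map; allFin)
open import Data.Nat.ListAction using (sum)
open import Data.Product using (Σ; _×_; _,_)
open import Relation.Nullary using (¬_; yes; no)
open import Relation.Nullary.Decidable using (⌊_⌋)
open import Relation.Binary.PropositionalEquality using (_≡_)

record Mat : Set where
  constructor mat
  field
    rows  : ℕ
    cols  : ℕ
    entry : Fin rows → Fin cols → Bool
open Mat public

ones : Mat → ℕ
ones M = sum (map (λ i → sum (map (λ j → if entry M i j then 1 else 0)
                                  (allFin (cols M))))
                  (allFin (rows M)))

StrictlyIncreasing : {k n : ℕ} → (Fin k → Fin n) → Set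
StrictlyIncreasing f = ∀ i j → i < j → f i < f j

-- A contains P: some submatrix of A (selected rows f, columns g) has a one
-- wherever P has a one (i.e. equals P after turning some ones into zeroes).
Contains : Mat → Mat → Set
Contains A P =
  Σ (Fin (rows P) → Fin (rows A)) λ f →
  Σ (Fin (cols P) → Fin (cols A)) λ g →
    StrictlyIncreasing f × StrictlyIncreasing g ×
    (∀ i j → entry P i j ≡ true → entry A (f i) (g j) ≡ true)

Avoids : Mat → Mat → Set
Avoids A P = ¬ Contains A P

IsLSM : Mat → Mat → ℕ → Set
IsLSM A P k =
  (Σ Mat λ B → Contains A B × Avoids B P × ones B ≡ k) ×
  (∀ B → Contains A B → Avoids B P → ones B ≤ k)

IsSM : ℕ → Mat → ℕ → Set
IsSM m P s =
  (Σ Mat λ A → ones A ≡ m × IsLSM A P s) ×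
  (∀ A k → ones A ≡ m → IsLSM A P k → s ≤ k)

-- Insert a new column between columns c and c+1 (0-indexed: c = inject₁ c,
-- c+1 = suc c) of P whose entry in row r is 1 and whose other entries are 0.
-- The new column has index suc (inject₁ c) in the result.
insertCol : {a b : ℕ} → (Fin a → Fin (suc b) → Bool) → Fin a → Fin b →
            Fin a → Fin (suc (suc b)) → Bool
insertCol P r c i j with suc (inject₁ c) ≟ j
... | yes _  = ⌊ i ≟ r ⌋
... | no neq = P i (punchOut neq)

-- R contains P (delete the inserted column), so every P-avoiding submatrix also
-- avoids R, giving sm(m,P) ≤ sm(m,R).  Conversely, from an R-avoiding B keep, in
-- every row, only the 1st, 3rd, 5th, … one.  This keeps at least half of the ones,
-- and the result avoids P: two kept ones of a row always have a one of B strictly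
-- between them, which would complete an occurrence of P into one of R.  Hence
-- sm(m,R) ≤ 2 sm(m,P).  The maxima defining LSM exist only classically (under ¬¬),
-- which is harmless since the inequalities to be proved are decidable.
module Submission where

open import Defs
open import Data.Nat using (ℕ; suc; _≤_; _*_)
open import Data.Fin using (Fin; suc; inject₁)
open import Data.Bool using (Bool; true)
open import Data.Product using (_×_)
open import Relation.Binary.PropositionalEquality using (_≡_)

open import Data.Nat as ℕ using (zero; _+_; z≤n; s≤s; _≤?_)
open import Data.Nat.Properties as ℕ
  using (≤-trans; ≤-refl; +-mono-≤; +-monoʳ-≤; *-monoʳ-≤; *-mono-≤; *-identityˡ)
open import Data.Nat.Tactic.RingSolver using (solve-∀)
open import Data.Fin as Fin using (zero; toℕ; punchIn; punchOut)
import Data.Fin.Properties as Fin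
open import Data.Bool using (false; not; _∧_; _xor_; if_then_else_)
open import Data.List using (map; allFin; tabulate)
open import Data.List.Properties using (map-tabulate)
open import Data.Nat.ListAction using (sum)
open import Data.Product using (Σ; Σ-syntax; ∃-syntax; _,_)
open import Data.Empty using (⊥-elim)
open import Function using (_∘_; id)
open import Relation.Nullary using (¬_; yes; no)
open import Relation.Nullary.Decidable using (decidable-stable; ¬¬-excluded-middle)
open import Relation.Nullary.Negation using (¬¬-map)
open import Relation.Binary.Definitions using (tri<; tri≈; tri>)
open import Relation.Binary.PropositionalEquality
  using (refl; sym; trans; cong; subst; module ≡-Reasoning)

private
  variable
    n : ℕ

sumFin : (Fin n → ℕ) → ℕ
sumFin {n} f = sum (map f (allFin n))

sumFin-suc : (f : Fin (suc n) → ℕ) → sumFin f ≡ f zero + sumFin (f ∘ suc)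
sumFin-suc {n} f = begin
  sum (map f (allFin (suc n)))       ≡⟨ cong sum (map-tabulate id f) ⟩
  f zero + sum (tabulate (f ∘ suc))  ≡⟨ cong (λ xs → f zero + sum xs) (sym (map-tabulate id (f ∘ suc))) ⟩
  f zero + sumFin (f ∘ suc)          ∎
  where open ≡-Reasoning

sumFin-mono : (f g : Fin n → ℕ) → (∀ i → f i ≤ g i) → sumFin f ≤ sumFin g
sumFin-mono {zero}  f g f≤g = z≤n
sumFin-mono {suc n} f g f≤g rewrite sumFin-suc f | sumFin-suc g =
  +-mono-≤ (f≤g zero) (sumFin-mono (f ∘ suc) (g ∘ suc) (f≤g ∘ suc))

sumFin-bounded : (f : Fin n → ℕ) (k : ℕ) → (∀ i → f i ≤ k) → sumFin f ≤ n * k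
sumFin-bounded {zero}  f k f≤k = z≤n
sumFin-bounded {suc n} f k f≤k rewrite sumFin-suc f =
  +-mono-≤ (f≤k zero) (sumFin-bounded (f ∘ suc) k (f≤k ∘ suc))

sumFin-*ˡ : (k : ℕ) (f : Fin n → ℕ) → sumFin (λ i → k * f i) ≡ k * sumFin f
sumFin-*ˡ {zero}  k f = sym (ℕ.*-zeroʳ k)
sumFin-*ˡ {suc n} k f = begin
  sumFin (λ i → k * f i)                     ≡⟨ sumFin-suc (λ i → k * f i) ⟩
  k * f zero + sumFin (λ i → k * f (suc i))  ≡⟨ cong (k * f zero +_) (sumFin-*ˡ k (f ∘ suc)) ⟩
  k * f zero + k * sumFin (f ∘ suc)          ≡⟨ sym (ℕ.*-distribˡ-+ k (f zero) _) ⟩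
  k * (f zero + sumFin (f ∘ suc))            ≡⟨ cong (k *_) (sym (sumFin-suc f)) ⟩
  k * sumFin f                               ∎
  where open ≡-Reasoning

bit : Bool → ℕ
bit b = if b then 1 else 0

count : (Fin n → Bool) → ℕ
count h = sumFin (bit ∘ h)

count-suc : (h : Fin (suc n) → Bool) → count h ≡ bit (h zero) + count (h ∘ suc)
count-suc h = sumFin-suc (bit ∘ h)

bit≤1 : ∀ b → bit b ≤ 1
bit≤1 true  = s≤s z≤n
bit≤1 false = z≤n

ones≤rows*cols : ∀ M → ones M ≤ rows M * cols M
ones≤rows*cols M = sumFin-bounded _ (cols M) λ i →
  subst (count (entry M i) ≤_) (ℕ.*-identityʳ (cols M))
        (sumFin-bounded _ 1 (bit≤1 ∘ entry M i))

private
  variable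
    k : ℕ

StrictlyIncreasing⇒injective : {f : Fin k → Fin n} → StrictlyIncreasing f →
                               ∀ {i j} → f i ≡ f j → i ≡ j
StrictlyIncreasing⇒injective sf {i} {j} fi≡fj with Fin.<-cmp i j
... | tri< i<j _ _ = ⊥-elim (Fin.<⇒≢ (sf i j i<j) fi≡fj)
... | tri≈ _ i≡j _ = i≡j
... | tri> _ _ j<i = ⊥-elim (Fin.<⇒≢ (sf j i j<i) (sym fi≡fj))

StrictlyIncreasing⇒≤ : {f : Fin k → Fin n} → StrictlyIncreasing f → k ≤ n
StrictlyIncreasing⇒≤ sf = Fin.injective⇒≤ (StrictlyIncreasing⇒injective sf)

StrictlyIncreasing⇒monotone : {f : Fin k → Fin n} → StrictlyIncreasing f →
                              ∀ {i j} → i Fin.≤ j → f i Fin.≤ f j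
StrictlyIncreasing⇒monotone sf {i} {j} i≤j with i Fin.≟ j
... | yes refl = ≤-refl
... | no  i≢j  = ℕ.<⇒≤ (sf i j (Fin.≤∧≢⇒< i≤j i≢j))

StrictlyIncreasing-∘ : ∀ {l} {f : Fin k → Fin n} {g : Fin l → Fin k} →
                       StrictlyIncreasing f → StrictlyIncreasing g → StrictlyIncreasing (f ∘ g)
StrictlyIncreasing-∘ sf sg i j i<j = sf _ _ (sg i j i<j)

Contains-refl : ∀ A → Contains A A
Contains-refl A = id , id , (λ _ _ → id) , (λ _ _ → id) , (λ _ _ → id)

Contains-trans : ∀ {A B C} → Contains A B → Contains B C → Contains A C
Contains-trans (f , g , sf , sg , A⊇B) (f′ , g′ , sf′ , sg′ , B⊇C) =
  f ∘ f′ , g ∘ g′ , StrictlyIncreasing-∘ sf sf′ , StrictlyIncreasing-∘ sg sg′ ,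
  λ i j Cij → A⊇B _ _ (B⊇C i j Cij)

Contains⇒ones≤ : ∀ {A B} → Contains A B → ones B ≤ rows A * cols A
Contains⇒ones≤ {B = B} (_ , _ , sf , sg , _) =
  ≤-trans (ones≤rows*cols B) (*-mono-≤ (StrictlyIncreasing⇒≤ sf) (StrictlyIncreasing⇒≤ sg))

emptyMat : Mat
emptyMat = mat 0 0 (λ ())

emptyMat-avoids : ∀ P → Fin (rows P) → Avoids emptyMat P
emptyMat-avoids P r (f , _) with f r
... | ()

Maximum : (ℕ → Set) → Set
Maximum Q = Σ[ k ∈ ℕ ] Q k × (∀ j → Q j → j ≤ k)

¬¬-maximum : (Q : ℕ → Set) → ∀ {k₀} → Q k₀ → ∀ d → (∀ j → Q j → j ≤ d) → ¬ ¬ Maximum Q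
¬¬-maximum Q {k₀} qk₀ zero    ≤0   ¬max = ¬max (k₀ , qk₀ , λ j qj → ≤-trans (≤0 j qj) z≤n)
¬¬-maximum Q      qk₀ (suc d) ≤1+d ¬max = ¬¬-excluded-middle λ where
  (yes q) → ¬max (suc d , q , ≤1+d)
  (no ¬q) → ¬¬-maximum Q qk₀ d (λ j qj → ℕ.s≤s⁻¹ (ℕ.≤∧≢⇒< (≤1+d j qj) λ { refl → ¬q qj })) ¬max

¬¬-lsm : ∀ A P → Fin (rows P) → ¬ ¬ (Σ ℕ (IsLSM A P))
¬¬-lsm A P r = ¬¬-map toLSM
  (¬¬-maximum Q (emptyMat , empty-contained , emptyMat-avoids P r , refl) (rows A * cols A)
              (λ { _ (B , A⊇B , _ , refl) → Contains⇒ones≤ {A} {B} A⊇B }))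
  where
  Q : ℕ → Set
  Q k = Σ Mat λ B → Contains A B × Avoids B P × ones B ≡ k

  empty-contained : Contains A emptyMat
  empty-contained = (λ ()) , (λ ()) , (λ ()) , (λ ()) , (λ ())

  toLSM : Maximum Q → Σ ℕ (IsLSM A P)
  toLSM (k , qk , max) = k , qk , λ B A⊇B B-av → max (ones B) (B , A⊇B , B-av , refl)

record ShrinksTo (k : ℕ) (Q P : Mat) : Set where
  constructor shrinksTo
  field
    shrink : ∀ B → Avoids B Q → Σ Mat λ B′ → Contains B B′ × Avoids B′ P × ones B ≤ k * ones B′

lsm-≤-* : ∀ {k Q P A s t} → ShrinksTo k Q P → IsLSM A P s → IsLSM A Q t → t ≤ k * s
lsm-≤-* {k} {A = A} (shrinksTo shrink) (_ , maxP) ((B , A⊇B , B-av , refl) , _) with shrink B B-av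
... | B′ , B⊇B′ , B′-av , B≤kB′ =
  ≤-trans B≤kB′ (*-monoʳ-≤ k (maxP B′ (Contains-trans {A} {B} {B′} A⊇B B⊇B′) B′-av))

sm-≤-* : ∀ {k Q P m s t} → Fin (rows Q) → ShrinksTo k Q P → IsSM m P s → IsSM m Q t → t ≤ k * s
sm-≤-* {k} {Q} {s = s} {t} q shrink ((A , onesA , lsmP) , _) (_ , minQ) =
  decidable-stable (t ≤? k * s) (¬¬-map bound (¬¬-lsm A Q q))
  where
  bound : Σ ℕ (IsLSM A Q) → t ≤ k * s
  bound (t′ , lsmQ) = ≤-trans (minQ A t′ onesA lsmQ) (lsm-≤-* {A = A} shrink lsmP lsmQ)

Contains⇒ShrinksTo1 : ∀ {Q P} → Contains Q P → ShrinksTo 1 P Q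
Contains⇒ShrinksTo1 {Q} {P} Q⊇P = shrinksTo λ B B-av →
  B , Contains-refl B , (λ B⊇Q → B-av (Contains-trans {B} {Q} B⊇Q Q⊇P)) ,
  subst (ones B ≤_) (sym (*-identityˡ (ones B))) ≤-refl

-- keepOdd p h keeps the ones of h of odd rank, where p records whether an
-- odd number of ones precedes the part of the row being scanned.
keepOdd : Bool → (Fin n → Bool) → Fin n → Bool
keepOdd {suc n} p h zero    = h zero ∧ not p
keepOdd {suc n} p h (suc j) = keepOdd (p xor h zero) (h ∘ suc) j

keepOdd-⊆ : ∀ p (h : Fin n → Bool) j → keepOdd p h j ≡ true → h j ≡ true
keepOdd-⊆ {suc n} p h zero    kept with h zero
... | true  = refl
... | false = kept
keepOdd-⊆ {suc n} p h (suc j) kept = keepOdd-⊆ (p xor h zero) (h ∘ suc) j kept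

count-keepOdd : ∀ p (h : Fin n → Bool) → count h ≤ 2 * count (keepOdd p h) + bit p
count-keepOdd {zero}  p h = z≤n
count-keepOdd {suc n} p h = begin
  count h                                      ≡⟨ count-suc h ⟩
  bit (h zero) + count (h ∘ suc)               ≤⟨ +-monoʳ-≤ (bit (h zero)) (count-keepOdd (p xor h zero) (h ∘ suc)) ⟩
  bit (h zero) + (2 * K + bit (p xor h zero))  ≡⟨ parity p (h zero) K ⟩
  2 * (bit (h zero ∧ not p) + K) + bit p       ≡⟨ cong (λ x → 2 * x + bit p) (sym (count-suc (keepOdd p h))) ⟩
  2 * count (keepOdd p h) + bit p              ∎
  where
  open ℕ.≤-Reasoning
  K : ℕ
  K = count (keepOdd (p xor h zero) (h ∘ suc))
  parity : ∀ p b K → bit b + (2 * K + bit (p xor b)) ≡ 2 * (bit (b ∧ not p) + K) + bit p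
  parity false false = solve-∀
  parity false true  = solve-∀
  parity true  false = solve-∀
  parity true  true  = solve-∀

keepOdd-true-head : (h : Fin (suc n) → Bool) → ¬ keepOdd true h zero ≡ true
keepOdd-true-head h kept with h zero | kept
... | true  | ()
... | false | ()

keepOdd-preceded : ∀ (h : Fin n → Bool) w → keepOdd true h w ≡ true →
                   ∃[ x ] x Fin.< w × h x ≡ true
keepOdd-preceded {suc n} h zero    kept = ⊥-elim (keepOdd-true-head h kept)
keepOdd-preceded {suc n} h (suc w) kept with h zero in h₀
... | true  = zero , s≤s z≤n , h₀
... | false with keepOdd-preceded (h ∘ suc) w kept
...   | x , x<w , hx = suc x , s≤s x<w , hx

keepOdd-gap : ∀ p (h : Fin n → Bool) u v → keepOdd p h u ≡ true → keepOdd p h v ≡ true →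
              u Fin.< v → ∃[ x ] u Fin.< x × x Fin.< v × h x ≡ true
keepOdd-gap {suc n} false h zero (suc v) ku kv _ with h zero
... | true with keepOdd-preceded (h ∘ suc) v kv
...   | x , x<v , hx = suc x , s≤s z≤n , s≤s x<v , hx
keepOdd-gap {suc n} true h zero v ku kv _ = ⊥-elim (keepOdd-true-head h ku)
keepOdd-gap {suc n} p h (suc u) (suc v) ku kv (s≤s u<v)
  with keepOdd-gap (p xor h zero) (h ∘ suc) u v ku kv u<v
... | x , u<x , x<v , hx = suc x , s≤s u<x , s≤s x<v , hx

halve : Mat → Mat
halve B = mat (rows B) (cols B) (λ i → keepOdd false (entry B i))

halve-contained : ∀ B → Contains B (halve B)
halve-contained B = id , id , (λ _ _ → id) , (λ _ _ → id) ,
                    λ i j → keepOdd-⊆ false (entry B i) j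

ones-halve : ∀ B → ones B ≤ 2 * ones (halve B)
ones-halve B = begin
  ones B                        ≤⟨ sumFin-mono _ _ (λ i → count-halve (entry B i)) ⟩
  sumFin (λ i → 2 * halved i)   ≡⟨ sumFin-*ˡ 2 halved ⟩
  2 * ones (halve B)            ∎
  where
  open ℕ.≤-Reasoning
  halved : Fin (rows B) → ℕ
  halved i = count (keepOdd false (entry B i))
  count-halve : (h : Fin n → Bool) → count h ≤ 2 * count (keepOdd false h)
  count-halve h = subst (count h ≤_) (ℕ.+-identityʳ _) (count-keepOdd false h)

punchOut-below : ∀ {i j : Fin (suc n)} (i≢j : ¬ i ≡ j) → j Fin.< i → toℕ (punchOut i≢j) ≡ toℕ j
punchOut-below {suc n} {suc i} {zero}  _   _         = refl
punchOut-below {suc n} {suc i} {suc j} i≢j (s≤s j<i) = cong suc (punchOut-below (i≢j ∘ cong suc) j<i)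

punchOut-above : ∀ {i j : Fin (suc n)} (i≢j : ¬ i ≡ j) → i Fin.< j → suc (toℕ (punchOut i≢j)) ≡ toℕ j
punchOut-above {_}     {zero}  {suc j} _   _         = refl
punchOut-above {suc n} {suc i} {suc j} i≢j (s≤s i<j) = cong suc (punchOut-above (i≢j ∘ cong suc) i<j)

module _ {b : ℕ} (c : Fin b) where

  newCol : Fin (suc (suc b))
  newCol = suc (inject₁ c)

  punchOut-before-newCol : ∀ {j} (new≢j : ¬ newCol ≡ j) → j Fin.< newCol → punchOut new≢j Fin.≤ inject₁ c
  punchOut-before-newCol new≢j j<new = ≤-trans (ℕ.≤-reflexive (punchOut-below new≢j j<new)) (ℕ.s≤s⁻¹ j<new)

  punchOut-after-newCol : ∀ {j} (new≢j : ¬ newCol ≡ j) → newCol Fin.< j → suc c Fin.≤ punchOut new≢j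
  punchOut-after-newCol new≢j new<j = ℕ.s≤s⁻¹ (begin
    ℕ.suc (ℕ.suc (toℕ c))         ≡⟨ cong (ℕ.suc ∘ ℕ.suc) (sym (Fin.toℕ-inject₁ c)) ⟩
    ℕ.suc (toℕ newCol)            ≤⟨ new<j ⟩
    toℕ _                         ≡⟨ sym (punchOut-above new≢j new<j) ⟩
    ℕ.suc (toℕ (punchOut new≢j))  ∎)
    where open ℕ.≤-Reasoning

  insertCol-punchIn : ∀ {a} (P : Fin a → Fin (suc b) → Bool) r i j →
                      insertCol P r c i (punchIn newCol j) ≡ P i j
  insertCol-punchIn P r i j with newCol Fin.≟ punchIn newCol j
  ... | yes new≡j = ⊥-elim (Fin.punchInᵢ≢i newCol j (sym new≡j))
  ... | no  new≢j = cong (P i) (trans (Fin.punchOut-cong newCol {i≢j = new≢j} refl) (Fin.punchOut-punchIn newCol))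

  insertCol-contains : ∀ {a} (P : Fin a → Fin (suc b) → Bool) r →
                       Contains (mat a (suc (suc b)) (insertCol P r c)) (mat a (suc b) P)
  insertCol-contains P r =
    id , punchIn newCol , (λ _ _ → id) , punchIn-strictlyIncreasing ,
    λ i j Pij → trans (insertCol-punchIn P r i j) Pij
    where
    punchIn-strictlyIncreasing : StrictlyIncreasing (punchIn newCol)
    punchIn-strictlyIncreasing i j i<j =
      Fin.≤∧≢⇒< (Fin.punchIn-mono-≤ newCol i j (ℕ.<⇒≤ i<j))
                (Fin.<⇒≢ i<j ∘ Fin.punchIn-injective newCol i j)

  extendCols : (Fin (suc b) → Fin n) → Fin n → Fin (suc (suc b)) → Fin n
  extendCols g x j with newCol Fin.≟ j
  ... | yes _    = x
  ... | no new≢j = g (punchOut new≢j)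

  extendCols-strictlyIncreasing : ∀ {g : Fin (suc b) → Fin n} {x} → StrictlyIncreasing g →
    g (inject₁ c) Fin.< x → x Fin.< g (suc c) → StrictlyIncreasing (extendCols g x)
  extendCols-strictlyIncreasing sg g<x x<g j k j<k with newCol Fin.≟ j | newCol Fin.≟ k
  ... | yes refl | yes refl = ⊥-elim (ℕ.<-irrefl refl j<k)
  ... | yes refl | no new≢k =
    ℕ.<-≤-trans x<g (StrictlyIncreasing⇒monotone sg (punchOut-after-newCol new≢k j<k))
  ... | no new≢j | yes refl =
    ℕ.≤-<-trans (StrictlyIncreasing⇒monotone sg (punchOut-before-newCol new≢j j<k)) g<x
  ... | no new≢j | no new≢k =
    sg _ _ (Fin.≤∧≢⇒< (Fin.punchOut-mono-≤ new≢j new≢k (ℕ.<⇒≤ j<k))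
                      (Fin.<⇒≢ j<k ∘ Fin.punchOut-injective new≢j new≢k))

  module _ {a} (P : Fin a → Fin (suc b) → Bool) (r : Fin a)
           (left : P r (inject₁ c) ≡ true) (right : P r (suc c) ≡ true) where

    R : Mat
    R = mat a (suc (suc b)) (insertCol P r c)

    -- The one of B lying between the two kept ones matched by columns c and c+1
    -- of row r supplies the inserted column.
    halve-avoids : ∀ B → Avoids B R → Avoids (halve B) (mat a (suc b) P)
    halve-avoids B B-av (f , g , sf , sg , occ)
      with keepOdd-gap false (entry B (f r)) (g (inject₁ c)) (g (suc c)) (occ r _ left) (occ r _ right)
                       (sg _ _ (ℕ.≤-reflexive (cong ℕ.suc (Fin.toℕ-inject₁ c))))
    ... | x , g<x , x<g , Bx = B-av (f , extendCols g x , sf , extendCols-strictlyIncreasing sg g<x x<g , occR)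
      where
      occR : ∀ i j → insertCol P r c i j ≡ true → entry B (f i) (extendCols g x j) ≡ true
      occR i j Rij with newCol Fin.≟ j
      occR i j Rij | yes _ with i Fin.≟ r
      occR i j Rij | yes _ | yes refl = Bx
      occR i j Rij | no _ = keepOdd-⊆ false (entry B (f i)) _ (occ i _ Rij)

    halve-ShrinksTo2 : ShrinksTo 2 R (mat a (suc b) P)
    halve-ShrinksTo2 = shrinksTo λ B B-av → halve B , halve-contained B , halve-avoids B B-av , ones-halve B

mainTheorem4 : (a b : ℕ) (P : Fin a → Fin (suc b) → Bool) (r : Fin a) (c : Fin b) →
    P r (inject₁ c) ≡ true → P r (suc c) ≡ true →
    ∀ m s t → IsSM m (mat a (suc b) P) s →
    IsSM m (mat a (suc (suc b)) (insertCol P r c)) t →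
    s ≤ t × t ≤ 2 * s
mainTheorem4 a b P r c left right m s t smP smR =
  subst (s ≤_) (*-identityˡ t) (sm-≤-* r (Contains⇒ShrinksTo1 (insertCol-contains c P r)) smR smP) ,
  sm-≤-* r (halve-ShrinksTo2 c P r left right) smP smR
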